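{- Let $ET$ be an extended tournament with $\chi'_{\mathrm{wo}}(ET)=3$, and let $x\in V(ET)$ be any prescribed vertex. Then there is a map $\varphi:A(ET)\to\{1,2\}$ such that condition (WO) holds at every vertex of $ET$ other than $x$.
   Context: A tournament is an orientation of a complete graph. Given a tournament $T$ with vertices $v_1,\dots,v_n$ and integers $s_1,\dots,s_n\ge 1$, the extended tournament $ET$ has vertex set $I_1\cup\dots\cup I_n$ (disjoint sets, $|I_i|=s_i$, each $I_i$ independent), and for $x\in I_i$, $y\in I_j$ ($i\ne j$) there is an arc $xy$ iff $v_iv_j\in A(T)$. For a vertex $v$ of a digraph $D$, the semi-cuts of $v$ are $\partial^+(v)$ (arcs leaving $v$) and $\partial^-(v)$ (arcs entering $v$). A map $\varphi:A(D)\to[k]=\{1,\dots,k\}$ satisfies condition (WO) at $v$ if there is a color $i\in[k]$ such that every nonempty semi-cut of $v$ contains an odd number of arcs of color $i$ (vacuous if both are empty). A weak-odd $k$-edge coloring is such a map satisfying (WO) at every vertex, and the weak-odd chromatic index $\chi'_{\mathrm{wo}}(D)$ is the least $k\ge0$ for which one exists. -}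

module Defs where

open import Data.Nat using (ℕ; zero; suc; _<_; _≥_; _%_)
open import Data.Fin using (Fin; _≟_)
open import Data.List using (List; []; _∷_; map; concatMap; length; filter; allFin)
open import Data.Bool using (Bool; true; false; _∧_)
open import Data.Product using (Σ; ∃; _×_; _,_; proj₁; proj₂)
open import Data.Sum using (_⊎_)
open import Relation.Nullary using (¬_; Dec; yes; no)
open import Relation.Nullary.Decidable using (⌊_⌋)
open import Relation.Binary.PropositionalEquality using (_≡_; _≢_)

record Tournament (n : ℕ) : Set where
  field
    arc      : Fin n → Fin n → Bool
    irrefl   : ∀ i → arc i i ≡ false
    oriented : ∀ i j → i ≢ j → (arc i j ≡ true × arc j i ≡ false) ⊎ (arc i j ≡ false × arc j i ≡ true)

open Tournament public

Odd : ℕ → Set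
Odd m = m % 2 ≡ 1

-- Vertex set of the extended tournament: I_i = {i} × Fin (s i).
ETVertex : {n : ℕ} → (s : Fin n → ℕ) → Set
ETVertex {n} s = Σ (Fin n) (λ i → Fin (s i))

etVertices : {n : ℕ} → (s : Fin n → ℕ) → List (ETVertex s)
etVertices {n} s = concatMap (λ i → map (λ a → (i , a)) (allFin (s i))) (allFin n)

-- Arc relation of ET (Boolean): xy is an arc iff v_i v_j ∈ A(T) (x ∈ I_i, y ∈ I_j).
-- Since arc T i i ≡ false, each I_i is independent.
etArc : {n : ℕ} (T : Tournament n) (s : Fin n → ℕ) → ETVertex s → ETVertex s → Bool
etArc T s x y = arc T (proj₁ x) (proj₁ y)

-- An arc colouring with k colours: a colour for each ordered pair (x , y);
-- only the values on arcs (etArc T s x y ≡ true) are ever used.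
ArcColouring : {n : ℕ} (s : Fin n → ℕ) (k : ℕ) → Set
ArcColouring s k = ETVertex s → ETVertex s → Fin k

outDeg inDeg : {n : ℕ} (T : Tournament n) (s : Fin n → ℕ) → ETVertex s → ℕ
outDeg T s v = length (filter (λ y → etArc T s v y ≟ᵇ true) (etVertices s))
  where
  open import Data.Bool using () renaming (_≟_ to _≟ᵇ_)
inDeg T s v = length (filter (λ y → etArc T s y v ≟ᵇ true) (etVertices s))
  where
  open import Data.Bool using () renaming (_≟_ to _≟ᵇ_)

outCol inCol : {n : ℕ} (T : Tournament n) (s : Fin n → ℕ) {k : ℕ} →
               ArcColouring s k → ETVertex s → Fin k → ℕ
outCol T s φ v c =
  length (filter (λ y → (etArc T s v y ∧ ⌊ φ v y ≟ c ⌋) ≟ᵇ true) (etVertices s))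
  where
  open import Data.Bool using () renaming (_≟_ to _≟ᵇ_)
inCol T s φ v c =
  length (filter (λ y → (etArc T s y v ∧ ⌊ φ y v ≟ c ⌋) ≟ᵇ true) (etVertices s))
  where
  open import Data.Bool using () renaming (_≟_ to _≟ᵇ_)

WO : {n : ℕ} (T : Tournament n) (s : Fin n → ℕ) {k : ℕ} → ArcColouring s k → ETVertex s → Set
WO T s {k} φ v =
  (outDeg T s v ≡ 0 × inDeg T s v ≡ 0)
  ⊎ (∃ λ (c : Fin k) → (outDeg T s v ≢ 0 → Odd (outCol T s φ v c))
                     × (inDeg T s v ≢ 0 → Odd (inCol T s φ v c)))

HasWeakOddColouring : {n : ℕ} (T : Tournament n) (s : Fin n → ℕ) → ℕ → Set
HasWeakOddColouring T s k = Σ (ArcColouring s k) (λ φ → ∀ v → WO T s φ v)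

WeakOddChromaticIndex≡ : {n : ℕ} (T : Tournament n) (s : Fin n → ℕ) → ℕ → Set
WeakOddChromaticIndex≡ T s m =
  HasWeakOddColouring T s m × (∀ k → k < m → ¬ HasWeakOddColouring T s k)

-- Colour an arc with the second colour iff it occurs an odd number of times in a list L of
-- arcs. The parities of the second colour at v are then the parities of the numbers of entries
-- of L with tail v and with head v, and (WO) at v becomes a parity demand on them: the tail
-- count must be odd if d⁺(v) is even and positive, the head count odd if d⁻(v) is even and
-- positive, and the two counts equal if d⁺(v) and d⁻(v) are both odd. L collects one zigzag
-- v → y ← u → y′ ← ⋯ for every v ≠ x with d⁺(v) even and positive; it ends at x, at a head
-- without demand, or passes through a vertex with both degrees odd. Vertices of one class I_i
-- have the same neighbours, so a case analysis in T finds such a zigzag unless |I_i| is even,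
-- and then the other vertices of I_i are instead paired with a base vertex of I_i through a common
-- out-neighbour. In-degree demands are met by the same construction in the reversed tournament.

module Submission where

open import Defs
open import Algebra.Bundles using (CommutativeRing)
open import Data.Bool using (Bool; true; false; not; _∧_; _xor_; if_then_else_) renaming (_≟_ to _≟ᵇ_)
open import Data.Bool.Properties
  using ( xor-assoc; xor-comm; xor-same; xor-identityʳ; true-xor; not-involutive
        ; ∧-identityʳ; ∧-zeroʳ; ∧-conicalˡ; ∧-conicalʳ; ∧-distribˡ-xor; ∧-distribʳ-xor
        ; xor-∧-commutativeRing )
open import Algebra.Properties.CommutativeSemigroup
  (CommutativeRing.+-commutativeSemigroup xor-∧-commutativeRing) using (interchange)
open import Data.Empty using (⊥-elim)
import Data.Fin as Fin
open import Data.Fin using (Fin; fromℕ<) renaming (_≟_ to _≟ᶠ_)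
open import Data.Fin.Patterns using (0F; 1F)
open import Data.Fin.Properties using (any?; suc-injective)
open import Data.List using (List; []; _∷_; _++_; map; concatMap; length; filter; allFin; tabulate)
open import Data.List.Properties using (length-tabulate)
import Data.List.Relation.Unary.All as All
open import Data.List.Relation.Unary.All using (All; []; _∷_)
open import Data.List.Relation.Unary.All.Properties using (++⁺; map⁺; concat⁺)
open import Data.Nat using (ℕ; zero; suc; _≥_)
import Data.Product as Product
open import Data.Product using (Σ; ∃; ∃₂; _×_; _,_; proj₁; proj₂; swap)
open import Data.Product.Properties using (≡-dec)
import Data.Sum as Sum
open import Data.Sum using (_⊎_; inj₁; inj₂)
open import Function using (_∘_; id)
open import Relation.Binary.Definitions using (DecidableEquality)
open import Relation.Binary.PropositionalEquality
  using (_≡_; _≢_; refl; sym; trans; cong; cong₂; subst; module ≡-Reasoning)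
open import Relation.Nullary using (¬_; Dec; yes; no)
open import Relation.Nullary.Decidable using (⌊_⌋; _×-dec_)

open ≡-Reasoning

true≢false : true ≢ false
true≢false ()

≢-by : {A : Set} (f : A → Bool) {a b : A} → f a ≡ true → f b ≡ false → a ≢ b
≢-by f fa fb refl = true≢false (trans (sym fa) fb)

xor-cancelˡ : ∀ p q → p xor (p xor q) ≡ q
xor-cancelˡ p q = trans (sym (xor-assoc p p q)) (cong (_xor q) (xor-same p))

module _ {A : Set} where

  ⌊⌋-yes : (a? : Dec A) → A → ⌊ a? ⌋ ≡ true
  ⌊⌋-yes (yes _) _ = refl
  ⌊⌋-yes (no ¬a) a = ⊥-elim (¬a a)

  ⌊⌋-no : (a? : Dec A) → ¬ A → ⌊ a? ⌋ ≡ false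
  ⌊⌋-no (yes a) ¬a = ⊥-elim (¬a a)
  ⌊⌋-no (no _)  _  = refl

  ⌊⌋-sound : (a? : Dec A) → ⌊ a? ⌋ ≡ true → A
  ⌊⌋-sound (yes a) _ = a

⌊≟⌋-sym : {A : Set} (_≟_ : DecidableEquality A) → ∀ a b → ⌊ a ≟ b ⌋ ≡ ⌊ b ≟ a ⌋
⌊≟⌋-sym _≟_ a b with a ≟ b
... | yes refl = sym (⌊⌋-yes (a ≟ a) refl)
... | no a≢b   = sym (⌊⌋-no (b ≟ a) (a≢b ∘ sym))

oddᵇ : ℕ → Bool
oddᵇ zero    = false
oddᵇ (suc m) = not (oddᵇ m)

oddᵇ⇒Odd : ∀ m → oddᵇ m ≡ true → Odd m
oddᵇ⇒Odd zero          ()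
oddᵇ⇒Odd (suc zero)    _ = refl
oddᵇ⇒Odd (suc (suc m)) e = oddᵇ⇒Odd m (trans (sym (not-involutive (oddᵇ m))) e)

-- Two colours on a semi-cut of size d: one is odd for free when d is odd, both must be odd when d is even and positive.
positiveEvenᵇ : ℕ → Bool
positiveEvenᵇ zero    = false
positiveEvenᵇ (suc m) = oddᵇ m

positiveEvenᵇ⇒≢0 : ∀ m → positiveEvenᵇ m ≡ true → m ≢ 0
positiveEvenᵇ⇒≢0 (suc m) _ ()

odd⇒¬positiveEvenᵇ : ∀ m → oddᵇ m ≡ true → positiveEvenᵇ m ≡ false
odd⇒¬positiveEvenᵇ (suc m) e = trans (sym (not-involutive (oddᵇ m))) (cong not e)

even⇒positiveEvenᵇ : ∀ m → oddᵇ m ≡ false → m ≢ 0 → positiveEvenᵇ m ≡ true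
even⇒positiveEvenᵇ zero    _ m≢0 = ⊥-elim (m≢0 refl)
even⇒positiveEvenᵇ (suc m) e _   = trans (sym (not-involutive (oddᵇ m))) (cong not e)

colourOf : Bool → Fin 2
colourOf b = if b then 1F else 0F

∧-colour₀ : ∀ a (col : Fin 2) → a ∧ ⌊ col ≟ᶠ 0F ⌋ ≡ a xor (a ∧ ⌊ col ≟ᶠ 1F ⌋)
∧-colour₀ false _  = refl
∧-colour₀ true  0F = refl
∧-colour₀ true  1F = refl

module _ (m : Fin 2 → ℕ) where

  Odd-colourOf : ∀ d → oddᵇ d ≡ true → oddᵇ (m 0F) ≡ oddᵇ d xor oddᵇ (m 1F) →
                 Odd (m (colourOf (oddᵇ (m 1F))))
  Odd-colourOf d odd-d m₀ with oddᵇ (m 1F) in m₁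
  ... | true  = oddᵇ⇒Odd (m 1F) m₁
  ... | false = oddᵇ⇒Odd (m 0F) (trans m₀ (cong (_xor false) odd-d))

  Odd-evenCut : ∀ d → oddᵇ d ≡ false → (positiveEvenᵇ d ≡ true → oddᵇ (m 1F) ≡ true) →
                oddᵇ (m 0F) ≡ oddᵇ d xor oddᵇ (m 1F) → ∀ col → d ≢ 0 → Odd (m col)
  Odd-evenCut d even-d m₁ m₀ 0F d≢0 =
    oddᵇ⇒Odd (m 0F) (trans m₀ (cong₂ _xor_ even-d (m₁ (even⇒positiveEvenᵇ d even-d d≢0))))
  Odd-evenCut d even-d m₁ m₀ 1F d≢0 = oddᵇ⇒Odd (m 1F) (m₁ (even⇒positiveEvenᵇ d even-d d≢0))

oddCommonColour : (d⁺ d⁻ : ℕ) (o i : Fin 2 → ℕ) →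
  oddᵇ (o 0F) ≡ oddᵇ d⁺ xor oddᵇ (o 1F) → oddᵇ (i 0F) ≡ oddᵇ d⁻ xor oddᵇ (i 1F) →
  (positiveEvenᵇ d⁺ ≡ true → oddᵇ (o 1F) ≡ true) → (positiveEvenᵇ d⁻ ≡ true → oddᵇ (i 1F) ≡ true) →
  (oddᵇ d⁺ ≡ true → oddᵇ d⁻ ≡ true → oddᵇ (o 1F) ≡ oddᵇ (i 1F)) →
  ∃ λ col → (d⁺ ≢ 0 → Odd (o col)) × (d⁻ ≢ 0 → Odd (i col))
oddCommonColour d⁺ d⁻ o i o₀ i₀ o₁ i₁ balanced = byParity (oddᵇ d⁺) (oddᵇ d⁻) refl refl
  where
  byParity : ∀ p q → oddᵇ d⁺ ≡ p → oddᵇ d⁻ ≡ q → ∃ λ col → (d⁺ ≢ 0 → Odd (o col)) × (d⁻ ≢ 0 → Odd (i col))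
  byParity false false p q = 1F , Odd-evenCut o d⁺ p o₁ o₀ 1F , Odd-evenCut i d⁻ q i₁ i₀ 1F
  byParity false true  p q = colourOf (oddᵇ (i 1F)) , Odd-evenCut o d⁺ p o₁ o₀ _ , λ _ → Odd-colourOf i d⁻ q i₀
  byParity true  false p q = colourOf (oddᵇ (o 1F)) , (λ _ → Odd-colourOf o d⁺ p o₀) , Odd-evenCut i d⁻ q i₁ i₀ _
  byParity true  true  p q = colourOf (oddᵇ (o 1F)) , (λ _ → Odd-colourOf o d⁺ p o₀) ,
    λ _ → subst (λ b → Odd (i (colourOf b))) (sym (balanced p q)) (Odd-colourOf i d⁻ q i₀)

module _ {A : Set} where

  xorSum : (A → Bool) → List A → Bool
  xorSum f []       = false
  xorSum f (a ∷ as) = f a xor xorSum f as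

  oddᵇ-length-filter : ∀ (f : A → Bool) xs → oddᵇ (length (filter (λ a → f a ≟ᵇ true) xs)) ≡ xorSum f xs
  oddᵇ-length-filter f []       = refl
  oddᵇ-length-filter f (a ∷ xs) with f a
  ... | true  = cong not (oddᵇ-length-filter f xs)
  ... | false = oddᵇ-length-filter f xs

  ∃-of-nonempty-filter : ∀ (f : A → Bool) xs → length (filter (λ a → f a ≟ᵇ true) xs) ≢ 0 → ∃ λ a → f a ≡ true
  ∃-of-nonempty-filter f []       nonempty = ⊥-elim (nonempty refl)
  ∃-of-nonempty-filter f (a ∷ xs) nonempty with f a in fa
  ... | true  = a , fa
  ... | false = ∃-of-nonempty-filter f xs nonempty

  xorSum-cong : ∀ {f g : A → Bool} → (∀ a → f a ≡ g a) → ∀ xs → xorSum f xs ≡ xorSum g xs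
  xorSum-cong f≗g []       = refl
  xorSum-cong f≗g (a ∷ xs) = cong₂ _xor_ (f≗g a) (xorSum-cong f≗g xs)

  xorSum-false : ∀ {f : A → Bool} → (∀ a → f a ≡ false) → ∀ xs → xorSum f xs ≡ false
  xorSum-false f≡false []       = refl
  xorSum-false f≡false (a ∷ xs) rewrite f≡false a = xorSum-false f≡false xs

  xorSum-true : ∀ xs → xorSum (λ _ → true) xs ≡ oddᵇ (length xs)
  xorSum-true []       = refl
  xorSum-true (a ∷ xs) = cong not (xorSum-true xs)

  xorSum-++ : ∀ f xs ys → xorSum f (xs ++ ys) ≡ xorSum f xs xor xorSum f ys
  xorSum-++ f []       ys = refl
  xorSum-++ f (a ∷ xs) ys = trans (cong (f a xor_) (xorSum-++ f xs ys)) (sym (xor-assoc (f a) _ _))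

  xorSum-xor : ∀ f g xs → xorSum (λ a → f a xor g a) xs ≡ xorSum f xs xor xorSum g xs
  xorSum-xor f g []       = refl
  xorSum-xor f g (a ∷ xs) = trans (cong ((f a xor g a) xor_) (xorSum-xor f g xs)) (interchange (f a) (g a) _ _)

  xorSum-∧ˡ : ∀ b f xs → xorSum (λ a → b ∧ f a) xs ≡ b ∧ xorSum f xs
  xorSum-∧ˡ b f []       = sym (∧-zeroʳ b)
  xorSum-∧ˡ b f (a ∷ xs) = trans (cong ((b ∧ f a) xor_) (xorSum-∧ˡ b f xs)) (sym (∧-distribˡ-xor b (f a) _))

  xorSum-∧ʳ : ∀ f b xs → xorSum (λ a → f a ∧ b) xs ≡ xorSum f xs ∧ b
  xorSum-∧ʳ f b []       = refl
  xorSum-∧ʳ f b (a ∷ xs) = trans (cong ((f a ∧ b) xor_) (xorSum-∧ʳ f b xs)) (sym (∧-distribʳ-xor b (f a) _))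

  xorSum-tabulate-false : ∀ {m} (f : A → Bool) (g : Fin m → A) → (∀ i → f (g i) ≡ false) → xorSum f (tabulate g) ≡ false
  xorSum-tabulate-false {zero}  f g _        = refl
  xorSum-tabulate-false {suc m} f g fg≡false rewrite fg≡false 0F =
    xorSum-tabulate-false f (g ∘ Fin.suc) (fg≡false ∘ Fin.suc)

  xorSum-tabulate-single : ∀ {m} (f : A → Bool) (g : Fin m → A) (h : Fin m) →
                           (∀ i → i ≢ h → f (g i) ≡ false) → xorSum f (tabulate g) ≡ f (g h)
  xorSum-tabulate-single {suc m} f g 0F others =
    trans (cong (f (g 0F) xor_) (xorSum-tabulate-false f (g ∘ Fin.suc) (λ i → others (Fin.suc i) λ ())))
          (xor-identityʳ _)
  xorSum-tabulate-single {suc m} f g (Fin.suc h) others rewrite others 0F (λ ()) =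
    xorSum-tabulate-single f (g ∘ Fin.suc) h (λ i i≢h → others (Fin.suc i) (i≢h ∘ suc-injective))

module _ {A B : Set} where

  xorSum-map : ∀ (f : B → Bool) (g : A → B) xs → xorSum f (map g xs) ≡ xorSum (f ∘ g) xs
  xorSum-map f g []       = refl
  xorSum-map f g (a ∷ xs) = cong (f (g a) xor_) (xorSum-map f g xs)

  xorSum-concatMap : ∀ (f : B → Bool) (g : A → List B) xs → xorSum f (concatMap g xs) ≡ xorSum (xorSum f ∘ g) xs
  xorSum-concatMap f g []       = refl
  xorSum-concatMap f g (a ∷ xs) =
    trans (xorSum-++ f (g a) (concatMap g xs)) (cong (xorSum f (g a) xor_) (xorSum-concatMap f g xs))

  xorSum-comm : ∀ (f : A → B → Bool) xs ys →
                xorSum (λ a → xorSum (f a) ys) xs ≡ xorSum (λ b → xorSum (λ a → f a b) xs) ys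
  xorSum-comm f []       ys = sym (xorSum-false (λ _ → refl) ys)
  xorSum-comm f (a ∷ xs) ys =
    trans (cong (xorSum (f a) ys xor_) (xorSum-comm f xs ys)) (sym (xorSum-xor (f a) _ ys))

module Arcs {n : ℕ} (T : Tournament n) where

  infix 4 _⇒_ _⇒?_

  _⇒_ : Fin n → Fin n → Set
  i ⇒ j = arc T i j ≡ true

  _⇒?_ : ∀ i j → Dec (i ⇒ j)
  i ⇒? j = arc T i j ≟ᵇ true

  ⇒-irrefl : ∀ {i j} → i ⇒ j → i ≢ j
  ⇒-irrefl {i} i⇒i refl = true≢false (trans (sym i⇒i) (irrefl T i))

  ⇒-asym : ∀ {i j} → i ⇒ j → ¬ j ⇒ i
  ⇒-asym {i} {j} i⇒j j⇒i with oriented T i j (⇒-irrefl i⇒j)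
  ... | inj₁ (_ , j↛i) = true≢false (trans (sym j⇒i) j↛i)
  ... | inj₂ (i↛j , _) = true≢false (trans (sym i⇒j) i↛j)

  ⇒-total : ∀ {i j} → i ≢ j → i ⇒ j ⊎ j ⇒ i
  ⇒-total {i} {j} i≢j = Sum.map proj₁ proj₂ (oriented T i j i≢j)

opposite : ∀ {n} → Tournament n → Tournament n
opposite T = record
  { arc      = λ i j → arc T j i
  ; irrefl   = irrefl T
  ; oriented = λ i j i≢j → Sum.swap (Sum.map swap swap (oriented T i j i≢j))
  }

module ExtendedTournament {n : ℕ} (s : Fin n → ℕ) where

  V : Set
  V = ETVertex s

  vertices : List V
  vertices = etVertices s

  _≟ᵛ_ : DecidableEquality V
  _≟ᵛ_ = ≡-dec _≟ᶠ_ _≟ᶠ_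

  ≟ᵛ-class : ∀ {u w : V} → proj₁ u ≢ proj₁ w → ⌊ u ≟ᵛ w ⌋ ≡ false
  ≟ᵛ-class u≢w = ⌊⌋-no _ (u≢w ∘ cong proj₁)

  xorSum-vertices : ∀ f → xorSum f vertices ≡ xorSum (λ i → xorSum (λ a → f (i , a)) (allFin (s i))) (allFin n)
  xorSum-vertices f =
    trans (xorSum-concatMap f _ (allFin n)) (xorSum-cong (λ i → xorSum-map f (i ,_) (allFin (s i))) (allFin n))

  xorSum-≟ᵛ : ∀ w → xorSum (λ y → ⌊ y ≟ᵛ w ⌋) vertices ≡ true
  xorSum-≟ᵛ (j , b) = begin
    xorSum (λ y → ⌊ y ≟ᵛ (j , b) ⌋) vertices
      ≡⟨ xorSum-vertices _ ⟩
    xorSum (λ i → xorSum (λ a → ⌊ (i , a) ≟ᵛ (j , b) ⌋) (allFin (s i))) (allFin n)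
      ≡⟨ xorSum-tabulate-single _ id j (λ i i≢j → xorSum-false (λ _ → ≟ᵛ-class i≢j) (allFin (s i))) ⟩
    xorSum (λ a → ⌊ (j , a) ≟ᵛ (j , b) ⌋) (allFin (s j))
      ≡⟨ xorSum-tabulate-single _ id b (λ a a≢b → ⌊⌋-no _ λ { refl → a≢b refl }) ⟩
    ⌊ (j , b) ≟ᵛ (j , b) ⌋
      ≡⟨ ⌊⌋-yes _ refl ⟩
    true ∎

  xorSum-≟ᵛ′ : ∀ w → xorSum (λ y → ⌊ w ≟ᵛ y ⌋) vertices ≡ true
  xorSum-≟ᵛ′ w = trans (xorSum-cong (⌊≟⌋-sym _≟ᵛ_ w) vertices) (xorSum-≟ᵛ w)

  xorSum-class : ∀ j → xorSum (λ y → ⌊ proj₁ y ≟ᶠ j ⌋) vertices ≡ oddᵇ (s j)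
  xorSum-class j = begin
    xorSum (λ y → ⌊ proj₁ y ≟ᶠ j ⌋) vertices
      ≡⟨ xorSum-vertices _ ⟩
    xorSum (λ i → xorSum (λ _ → ⌊ i ≟ᶠ j ⌋) (allFin (s i))) (allFin n)
      ≡⟨ xorSum-tabulate-single _ id j (λ i i≢j → xorSum-false (λ _ → ⌊⌋-no _ i≢j) (allFin (s i))) ⟩
    xorSum (λ _ → ⌊ j ≟ᶠ j ⌋) (allFin (s j))
      ≡⟨ xorSum-cong (λ _ → ⌊⌋-yes _ refl) (allFin (s j)) ⟩
    xorSum (λ _ → true) (allFin (s j))
      ≡⟨ xorSum-true (allFin (s j)) ⟩
    oddᵇ (length (allFin (s j)))
      ≡⟨ cong oddᵇ (length-tabulate {n = s j} id) ⟩
    oddᵇ (s j) ∎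

  xorSum-class-except : ∀ j b → xorSum (λ y → ⌊ proj₁ y ≟ᶠ j ⌋ xor ⌊ y ≟ᵛ (j , b) ⌋) vertices ≡ not (oddᵇ (s j))
  xorSum-class-except j b = begin
    xorSum (λ y → ⌊ proj₁ y ≟ᶠ j ⌋ xor ⌊ y ≟ᵛ (j , b) ⌋) vertices
      ≡⟨ xorSum-xor _ _ vertices ⟩
    xorSum (λ y → ⌊ proj₁ y ≟ᶠ j ⌋) vertices xor xorSum (λ y → ⌊ y ≟ᵛ (j , b) ⌋) vertices
      ≡⟨ cong₂ _xor_ (xorSum-class j) (xorSum-≟ᵛ (j , b)) ⟩
    oddᵇ (s j) xor true
      ≡⟨ trans (xor-comm _ true) (true-xor _) ⟩
    not (oddᵇ (s j)) ∎

  tails heads : V → List (V × V) → Bool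
  tails w = xorSum (λ e → ⌊ proj₁ e ≟ᵛ w ⌋)
  heads w = xorSum (λ e → ⌊ proj₂ e ≟ᵛ w ⌋)

  oddMultiplicity : List (V × V) → V → V → Bool
  oddMultiplicity L u y = xorSum (λ e → ⌊ proj₁ e ≟ᵛ u ⌋ ∧ ⌊ proj₂ e ≟ᵛ y ⌋) L

  colouringOf : List (V × V) → ArcColouring s 2
  colouringOf L u y = colourOf (oddMultiplicity L u y)

  module Colouring (T : Tournament n) where

    IsArc : V × V → Set
    IsArc e = etArc T s (proj₁ e) (proj₂ e) ≡ true

    nonArc-entry : ∀ {t h u y} → etArc T s t h ≡ true → etArc T s u y ≡ false → ⌊ t ≟ᵛ u ⌋ ∧ ⌊ h ≟ᵛ y ⌋ ≡ false
    nonArc-entry {t} {h} {u} {y} th uy with t ≟ᵛ u | h ≟ᵛ y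
    ... | yes refl | yes refl = ⊥-elim (true≢false (trans (sym th) uy))
    ... | yes _    | no _     = refl
    ... | no _     | _        = refl

    oddMultiplicity-nonArc : ∀ {L} → All IsArc L → ∀ {u y} → etArc T s u y ≡ false → oddMultiplicity L u y ≡ false
    oddMultiplicity-nonArc []            _  = refl
    oddMultiplicity-nonArc (th ∷ arcs) uy = cong₂ _xor_ (nonArc-entry th uy) (oddMultiplicity-nonArc arcs uy)

    colour₁-on-arcs : ∀ {L} → All IsArc L → ∀ u y →
                      etArc T s u y ∧ ⌊ colouringOf L u y ≟ᶠ 1F ⌋ ≡ oddMultiplicity L u y
    colour₁-on-arcs {L} arcs u y with etArc T s u y in uy | oddMultiplicity L u y in m
    ... | true  | true  = refl
    ... | true  | false = refl
    ... | false | _     = trans (sym (oddMultiplicity-nonArc arcs uy)) m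

    oddᵇ-outCol₁ : ∀ {L} → All IsArc L → ∀ u → oddᵇ (outCol T s (colouringOf L) u 1F) ≡ tails u L
    oddᵇ-outCol₁ {L} arcs u = begin
      oddᵇ (outCol T s (colouringOf L) u 1F)
        ≡⟨ oddᵇ-length-filter _ vertices ⟩
      xorSum (λ y → etArc T s u y ∧ ⌊ colouringOf L u y ≟ᶠ 1F ⌋) vertices
        ≡⟨ xorSum-cong (colour₁-on-arcs arcs u) vertices ⟩
      xorSum (oddMultiplicity L u) vertices
        ≡⟨ xorSum-comm _ vertices L ⟩
      xorSum (λ e → xorSum (λ y → ⌊ proj₁ e ≟ᵛ u ⌋ ∧ ⌊ proj₂ e ≟ᵛ y ⌋) vertices) L
        ≡⟨ xorSum-cong (λ e → trans (xorSum-∧ˡ _ _ vertices) (cong (⌊ proj₁ e ≟ᵛ u ⌋ ∧_) (xorSum-≟ᵛ′ (proj₂ e)))) L ⟩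
      xorSum (λ e → ⌊ proj₁ e ≟ᵛ u ⌋ ∧ true) L
        ≡⟨ xorSum-cong (λ e → ∧-identityʳ _) L ⟩
      tails u L ∎

    oddᵇ-inCol₁ : ∀ {L} → All IsArc L → ∀ u → oddᵇ (inCol T s (colouringOf L) u 1F) ≡ heads u L
    oddᵇ-inCol₁ {L} arcs u = begin
      oddᵇ (inCol T s (colouringOf L) u 1F)
        ≡⟨ oddᵇ-length-filter _ vertices ⟩
      xorSum (λ y → etArc T s y u ∧ ⌊ colouringOf L y u ≟ᶠ 1F ⌋) vertices
        ≡⟨ xorSum-cong (λ y → colour₁-on-arcs arcs y u) vertices ⟩
      xorSum (λ y → oddMultiplicity L y u) vertices
        ≡⟨ xorSum-comm _ vertices L ⟩
      xorSum (λ e → xorSum (λ y → ⌊ proj₁ e ≟ᵛ y ⌋ ∧ ⌊ proj₂ e ≟ᵛ u ⌋) vertices) L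
        ≡⟨ xorSum-cong (λ e → trans (xorSum-∧ʳ _ _ vertices) (cong (_∧ ⌊ proj₂ e ≟ᵛ u ⌋) (xorSum-≟ᵛ′ (proj₁ e)))) L ⟩
      heads u L ∎

    oddᵇ-count₀ : ∀ (a : V → Bool) (col : V → Fin 2) →
      oddᵇ (length (filter (λ y → (a y ∧ ⌊ col y ≟ᶠ 0F ⌋) ≟ᵇ true) vertices))
        ≡ oddᵇ (length (filter (λ y → a y ≟ᵇ true) vertices))
          xor oddᵇ (length (filter (λ y → (a y ∧ ⌊ col y ≟ᶠ 1F ⌋) ≟ᵇ true) vertices))
    oddᵇ-count₀ a col = begin
      oddᵇ (length (filter (λ y → (a y ∧ ⌊ col y ≟ᶠ 0F ⌋) ≟ᵇ true) vertices))
        ≡⟨ oddᵇ-length-filter _ vertices ⟩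
      xorSum (λ y → a y ∧ ⌊ col y ≟ᶠ 0F ⌋) vertices
        ≡⟨ xorSum-cong (λ y → ∧-colour₀ (a y) (col y)) vertices ⟩
      xorSum (λ y → a y xor (a y ∧ ⌊ col y ≟ᶠ 1F ⌋)) vertices
        ≡⟨ xorSum-xor _ _ vertices ⟩
      xorSum a vertices xor xorSum (λ y → a y ∧ ⌊ col y ≟ᶠ 1F ⌋) vertices
        ≡⟨ sym (cong₂ _xor_ (oddᵇ-length-filter _ vertices) (oddᵇ-length-filter _ vertices)) ⟩
      oddᵇ (length (filter (λ y → a y ≟ᵇ true) vertices))
        xor oddᵇ (length (filter (λ y → (a y ∧ ⌊ col y ≟ᶠ 1F ⌋) ≟ᵇ true) vertices)) ∎

    WO-from-colour₁ : ∀ (φ : ArcColouring s 2) v →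
      (positiveEvenᵇ (outDeg T s v) ≡ true → oddᵇ (outCol T s φ v 1F) ≡ true) →
      (positiveEvenᵇ (inDeg T s v) ≡ true → oddᵇ (inCol T s φ v 1F) ≡ true) →
      (oddᵇ (outDeg T s v) ≡ true → oddᵇ (inDeg T s v) ≡ true → oddᵇ (outCol T s φ v 1F) ≡ oddᵇ (inCol T s φ v 1F)) →
      WO T s φ v
    WO-from-colour₁ φ v out₁ in₁ balanced = inj₂ (oddCommonColour _ _ (outCol T s φ v) (inCol T s φ v)
      (oddᵇ-count₀ (etArc T s v) (φ v)) (oddᵇ-count₀ (λ y → etArc T s y v) (λ y → φ y v)) out₁ in₁ balanced)

  module Construction (s≥1 : ∀ i → s i ≥ 1) (x : V) where

    home : Fin n
    home = proj₁ x

    baseIndex : (i : Fin n) → Fin (s i)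
    baseIndex i = fromℕ< (s≥1 i)

    base : Fin n → V
    base i = i , baseIndex i

    isBase : V → Bool
    isBase (i , a) = ⌊ a ≟ᶠ baseIndex i ⌋

    ≟ᵛ-x : ∀ {w} → w ≢ x → ⌊ x ≟ᵛ w ⌋ ≡ false
    ≟ᵛ-x w≢x = ⌊⌋-no _ (w≢x ∘ sym)

    module OutRoutes (T : Tournament n) where
      open Arcs T
      open Colouring T

      outDegᶜ inDegᶜ : Fin n → ℕ
      outDegᶜ i = outDeg T s (base i)
      inDegᶜ i = inDeg T s (base i)

      needsOut needsIn : Fin n → Bool
      needsOut i = positiveEvenᵇ (outDegᶜ i)
      needsIn i = positiveEvenᵇ (inDegᶜ i)

      needsOut⇒≢outOdd : ∀ {i j} → needsOut i ≡ true → oddᵇ (outDegᶜ j) ≡ true → i ≢ j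
      needsOut⇒≢outOdd {j = j} d odd = ≢-by needsOut d (odd⇒¬positiveEvenᵇ (outDegᶜ j) odd)

      out-neighbour : ∀ {i} → needsOut i ≡ true → ∃ λ r → i ⇒ r
      out-neighbour {i} d =
        Product.map proj₁ id (∃-of-nonempty-filter (λ y → arc T i (proj₁ y)) vertices (positiveEvenᵇ⇒≢0 _ d))

      data Escape (i : Fin n) : Set where
        toHome          : i ⇒ home → Escape i
        commonOut       : (r : Fin n) → i ⇒ r → home ⇒ r → Escape i
        twoStep         : (k k′ : Fin n) → i ⇒ k → k′ ⇒ k → k′ ⇒ home → Escape i
        throughBalanced : (k : Fin n) → i ⇒ k → k ⇒ home →
                          oddᵇ (outDegᶜ k) ≡ true → oddᵇ (inDegᶜ k) ≡ true → Escape i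
        toFreeHead      : (k : Fin n) → i ⇒ k → oddᵇ (outDegᶜ k) ≡ false → oddᵇ (inDegᶜ k) ≡ true → Escape i
        threeStep       : (k l r : Fin n) → i ⇒ k → l ⇒ k → l ⇒ r → home ⇒ r → Escape i

      escapeArcs : ∀ {i} → V → Escape i → List (V × V)
      escapeArcs v (toHome _)                  = (v , x) ∷ []
      escapeArcs v (commonOut r _ _)           = (v , base r) ∷ (x , base r) ∷ []
      escapeArcs v (twoStep k k′ _ _ _)        = (v , base k) ∷ (base k′ , base k) ∷ (base k′ , x) ∷ []
      escapeArcs v (throughBalanced k _ _ _ _) = (v , base k) ∷ (base k , x) ∷ []
      escapeArcs v (toFreeHead k _ _ _)        = (v , base k) ∷ []
      escapeArcs v (threeStep k l r _ _ _ _)   =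
        (v , base k) ∷ (base l , base k) ∷ (base l , base r) ∷ (x , base r) ∷ []

      data OutRoute (i : Fin n) : Set where
        unneeded : needsOut i ≡ false → OutRoute i
        escape   : needsOut i ≡ true → Escape i → OutRoute i
        paired   : needsOut i ≡ true → home ⇒ i → (k : Fin n) → i ⇒ k → oddᵇ (s i) ≡ false → OutRoute i

      routeArcs : (v : V) → OutRoute (proj₁ v) → List (V × V)
      routeArcs v (unneeded _)       = []
      routeArcs v (escape _ ε)       = escapeArcs v ε
      routeArcs v (paired _ _ k _ _) = if isBase v then [] else (v , base k) ∷ (base (proj₁ v) , base k) ∷ []

      CommonOut TwoStep OddInDegreeOut ThreeStep : Fin n → Set
      CommonOut i      = ∃ λ r → i ⇒ r × home ⇒ r
      TwoStep i        = ∃₂ λ k k′ → i ⇒ k × k′ ⇒ k × k′ ⇒ home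
      OddInDegreeOut i = ∃ λ k → i ⇒ k × oddᵇ (inDegᶜ k) ≡ true
      ThreeStep i      = ∃ λ k → ∃₂ λ l r → i ⇒ k × l ⇒ k × l ⇒ r × home ⇒ r

      commonOut? : ∀ i → Dec (CommonOut i)
      commonOut? i = any? λ r → i ⇒? r ×-dec home ⇒? r

      ⇒home-unless-commonOut : ∀ {i k} → home ⇒ i → ¬ CommonOut i → i ⇒ k → k ⇒ home
      ⇒home-unless-commonOut {i} {k} home⇒i ¬common i⇒k with ⇒-total {k} {home} (λ { refl → ⇒-asym i⇒k home⇒i })
      ... | inj₁ k⇒home = k⇒home
      ... | inj₂ home⇒k = ⊥-elim (¬common (k , i⇒k , home⇒k))

      -- Without an escape, the in-neighbours of any out-neighbour k of i are exactly the
      -- vertices of I_i, so |I_i| = d⁻(k) is even.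
      even-of-noEscape : ∀ {i k} → home ⇒ i → ¬ CommonOut i → ¬ TwoStep i → ¬ OddInDegreeOut i → ¬ ThreeStep i →
                         i ⇒ k → oddᵇ (s i) ≡ false
      even-of-noEscape {i} {k} home⇒i ¬common ¬two ¬odd ¬three i⇒k = begin
        oddᵇ (s i)                                 ≡⟨ sym (xorSum-class i) ⟩
        xorSum (λ y → ⌊ proj₁ y ≟ᶠ i ⌋) vertices  ≡⟨ sym (xorSum-cong (in-neighbours-of-k ∘ proj₁) vertices) ⟩
        xorSum (λ y → arc T (proj₁ y) k) vertices  ≡⟨ sym (oddᵇ-length-filter _ vertices) ⟩
        oddᵇ (inDegᶜ k)                            ≡⟨ even-inDeg ⟩
        false                                      ∎
        where
        even-inDeg : oddᵇ (inDegᶜ k) ≡ false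
        even-inDeg with oddᵇ (inDegᶜ k) in odd
        ... | false = refl
        ... | true  = ⊥-elim (¬odd (k , i⇒k , odd))

        in-neighbours-of-k : ∀ l → arc T l k ≡ ⌊ l ≟ᶠ i ⌋
        in-neighbours-of-k l with l ≟ᶠ i
        ... | yes refl = i⇒k
        ... | no l≢i with arc T l k in l⇒k
        ...   | false = refl
        ...   | true with l ≟ᶠ home
        ...     | yes refl = ⊥-elim (¬common (k , i⇒k , l⇒k))
        ...     | no l≢home with ⇒-total l≢home
        ...       | inj₁ l⇒home = ⊥-elim (¬two (k , l , i⇒k , l⇒k , l⇒home))
        ...       | inj₂ home⇒l with commonOut? l
        ...         | yes (r , l⇒r , home⇒r) = ⊥-elim (¬three (k , l , r , i⇒k , l⇒k , l⇒r , home⇒r))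
        ...         | no ¬common-l with ⇒-total (l≢i ∘ sym)
        ...           | inj₁ i⇒l = ⊥-elim (¬common (l , i⇒l , home⇒l))
        ...           | inj₂ l⇒i = ⊥-elim (¬common-l (i , l⇒i , home⇒i))

      throughOddInDegree : ∀ {i k} → home ⇒ i → ¬ CommonOut i → i ⇒ k → oddᵇ (inDegᶜ k) ≡ true → Escape i
      throughOddInDegree {k = k} home⇒i ¬common i⇒k odd-in with oddᵇ (outDegᶜ k) in odd-out
      ... | true  = throughBalanced k i⇒k (⇒home-unless-commonOut home⇒i ¬common i⇒k) odd-out odd-in
      ... | false = toFreeHead k i⇒k odd-out odd-in

      routeBelowHome : ∀ {i} → needsOut i ≡ true → home ⇒ i → OutRoute i
      routeBelowHome {i} d home⇒i with commonOut? i
      ... | yes (r , i⇒r , home⇒r) = escape d (commonOut r i⇒r home⇒r)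
      ... | no ¬common with any? (λ k → any? λ k′ → i ⇒? k ×-dec k′ ⇒? k ×-dec k′ ⇒? home)
      ...   | yes (k , k′ , i⇒k , k′⇒k , k′⇒home) = escape d (twoStep k k′ i⇒k k′⇒k k′⇒home)
      ...   | no ¬two with any? (λ k → i ⇒? k ×-dec oddᵇ (inDegᶜ k) ≟ᵇ true)
      ...     | yes (k , i⇒k , odd-in) = escape d (throughOddInDegree home⇒i ¬common i⇒k odd-in)
      ...     | no ¬odd with any? (λ k → any? λ l → any? λ r → i ⇒? k ×-dec l ⇒? k ×-dec l ⇒? r ×-dec home ⇒? r)
      ...       | yes (k , l , r , i⇒k , l⇒k , l⇒r , home⇒r) = escape d (threeStep k l r i⇒k l⇒k l⇒r home⇒r)
      ...       | no ¬three =
        let (k , i⇒k) = out-neighbour d in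
        paired d home⇒i k i⇒k (even-of-noEscape home⇒i ¬common ¬two ¬odd ¬three i⇒k)

      classify : ∀ i → OutRoute i
      classify i with needsOut i in d
      ... | false = unneeded d
      ... | true with i ≟ᶠ home
      ...   | yes refl = let (r , i⇒r) = out-neighbour d in escape d (commonOut r i⇒r i⇒r)
      ...   | no i≢home with ⇒-total i≢home
      ...     | inj₁ i⇒home = escape d (toHome i⇒home)
      ...     | inj₂ home⇒i = routeBelowHome d home⇒i

      route : V → List (V × V)
      route v = routeArcs v (classify (proj₁ v))

      tails-escape : ∀ {i} (ε : Escape i) a w → w ≢ x → needsOut (proj₁ w) ≡ true →
                     tails w (escapeArcs (i , a) ε) ≡ ⌊ (i , a) ≟ᵛ w ⌋
      tails-escape (toHome _) a w _ _ = xor-identityʳ _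
      tails-escape (commonOut _ _ _) a w w≢x _ rewrite ≟ᵛ-x w≢x = xor-identityʳ _
      tails-escape (twoStep _ k′ _ _ _) a w _ _ =
        trans (cong (⌊ (_ , a) ≟ᵛ w ⌋ xor_) (xor-cancelˡ ⌊ base k′ ≟ᵛ w ⌋ false)) (xor-identityʳ _)
      tails-escape (throughBalanced k _ _ odd-out _) a w _ dw
        rewrite ≟ᵛ-class {base k} {w} (needsOut⇒≢outOdd dw odd-out ∘ sym) = xor-identityʳ _
      tails-escape (toFreeHead _ _ _ _) a w _ _ = xor-identityʳ _
      tails-escape (threeStep _ l _ _ _ _ _) a w w≢x _ rewrite ≟ᵛ-x w≢x =
        trans (cong (⌊ (_ , a) ≟ᵛ w ⌋ xor_) (xor-cancelˡ ⌊ base l ≟ᵛ w ⌋ false)) (xor-identityʳ _)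

      heads-escape : ∀ {i} (ε : Escape i) a w → w ≢ x → needsIn (proj₁ w) ≡ true →
                     heads w (escapeArcs (i , a) ε) ≡ false
      heads-escape (toHome _) a w w≢x _ rewrite ≟ᵛ-x w≢x = refl
      heads-escape (commonOut r _ _) a w _ _ = xor-cancelˡ ⌊ base r ≟ᵛ w ⌋ false
      heads-escape (twoStep k _ _ _ _) a w w≢x _ rewrite ≟ᵛ-x w≢x = xor-cancelˡ ⌊ base k ≟ᵛ w ⌋ false
      heads-escape (throughBalanced k _ _ _ odd-in) a w w≢x dw
        rewrite ≟ᵛ-class {base k} {w} (≢-by needsIn dw (odd⇒¬positiveEvenᵇ (inDegᶜ k) odd-in) ∘ sym) | ≟ᵛ-x w≢x = refl
      heads-escape (toFreeHead k _ _ odd-in) a w _ dw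
        rewrite ≟ᵛ-class {base k} {w} (≢-by needsIn dw (odd⇒¬positiveEvenᵇ (inDegᶜ k) odd-in) ∘ sym) = refl
      heads-escape (threeStep k _ r _ _ _ _) a w _ _ =
        trans (xor-cancelˡ ⌊ base k ≟ᵛ w ⌋ _) (xor-cancelˡ ⌊ base r ≟ᵛ w ⌋ false)

      escape-balanced : ∀ {i} (ε : Escape i) a w → w ≢ x → needsOut i ≡ true →
                        oddᵇ (outDegᶜ (proj₁ w)) ≡ true → oddᵇ (inDegᶜ (proj₁ w)) ≡ true →
                        tails w (escapeArcs (i , a) ε) ≡ heads w (escapeArcs (i , a) ε)
      escape-balanced (toHome _) a w w≢x d odd-out _
        rewrite ≟ᵛ-class {(_ , a)} {w} (needsOut⇒≢outOdd d odd-out) | ≟ᵛ-x w≢x = refl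
      escape-balanced (commonOut r _ _) a w w≢x d odd-out _
        rewrite ≟ᵛ-class {(_ , a)} {w} (needsOut⇒≢outOdd d odd-out) | ≟ᵛ-x w≢x =
        sym (xor-cancelˡ ⌊ base r ≟ᵛ w ⌋ false)
      escape-balanced (twoStep k k′ _ _ _) a w w≢x d odd-out _
        rewrite ≟ᵛ-class {(_ , a)} {w} (needsOut⇒≢outOdd d odd-out) | ≟ᵛ-x w≢x =
        trans (xor-cancelˡ ⌊ base k′ ≟ᵛ w ⌋ false) (sym (xor-cancelˡ ⌊ base k ≟ᵛ w ⌋ false))
      escape-balanced (throughBalanced _ _ _ _ _) a w w≢x d odd-out _
        rewrite ≟ᵛ-class {(_ , a)} {w} (needsOut⇒≢outOdd d odd-out) | ≟ᵛ-x w≢x = refl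
      escape-balanced (toFreeHead k _ even-out _) a w _ d odd-out _
        rewrite ≟ᵛ-class {(_ , a)} {w} (needsOut⇒≢outOdd d odd-out)
              | ≟ᵛ-class {base k} {w} (≢-by (oddᵇ ∘ outDegᶜ) odd-out even-out ∘ sym) = refl
      escape-balanced (threeStep k l r _ _ _ _) a w w≢x d odd-out _
        rewrite ≟ᵛ-class {(_ , a)} {w} (needsOut⇒≢outOdd d odd-out) | ≟ᵛ-x w≢x =
        trans (xor-cancelˡ ⌊ base l ≟ᵛ w ⌋ false)
              (sym (trans (xor-cancelˡ ⌊ base k ≟ᵛ w ⌋ _) (xor-cancelˡ ⌊ base r ≟ᵛ w ⌋ false)))

      escape-arcs : ∀ {i} (ε : Escape i) a → All IsArc (escapeArcs (i , a) ε)
      escape-arcs (toHome i⇒home) _                 = i⇒home ∷ []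
      escape-arcs (commonOut _ i⇒r home⇒r) _        = i⇒r ∷ home⇒r ∷ []
      escape-arcs (twoStep _ _ i⇒k k′⇒k k′⇒home) _  = i⇒k ∷ k′⇒k ∷ k′⇒home ∷ []
      escape-arcs (throughBalanced _ i⇒k k⇒home _ _) _ = i⇒k ∷ k⇒home ∷ []
      escape-arcs (toFreeHead _ i⇒k _ _) _          = i⇒k ∷ []
      escape-arcs (threeStep _ _ _ i⇒k l⇒k l⇒r home⇒r) _ = i⇒k ∷ l⇒k ∷ l⇒r ∷ home⇒r ∷ []

      isPaired : ∀ {i} → OutRoute i → Bool
      isPaired (paired _ _ _ _ _) = true
      isPaired _                  = false

      -- The base vertex of a paired class receives the other end of every pairing zigzag of its class.
      isHub : V → Bool
      isHub w = isPaired (classify (proj₁ w)) ∧ isBase w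

      paired-info : ∀ j → isPaired (classify j) ≡ true → needsOut j ≡ true × home ⇒ j × oddᵇ (s j) ≡ false
      paired-info j paired-j with classify j
      ... | paired d home⇒j _ _ even = d , home⇒j , even
      ... | unneeded _ = ⊥-elim (true≢false (sym paired-j))
      ... | escape _ _ = ⊥-elim (true≢false (sym paired-j))

      base≢nonHub : ∀ {i} w → isPaired (classify i) ≡ true → (proj₁ w ≡ i → isHub w ≡ false) → ⌊ base i ≟ᵛ w ⌋ ≡ false
      base≢nonHub {i} w paired-i not-hub = ⌊⌋-no _ λ { refl →
        true≢false (trans (sym (cong₂ _∧_ paired-i (⌊⌋-yes (baseIndex i ≟ᶠ baseIndex i) refl))) (not-hub refl)) }

      tails-route : ∀ v w → w ≢ x → needsOut (proj₁ w) ≡ true → (proj₁ w ≡ proj₁ v → isHub w ≡ false) →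
                    tails w (route v) ≡ ⌊ v ≟ᵛ w ⌋
      tails-route (i , a) w w≢x dw not-hub with classify i in class-i
      ... | unneeded d = sym (≟ᵛ-class (≢-by needsOut dw d ∘ sym))
      ... | escape _ ε = tails-escape ε a w w≢x dw
      ... | paired _ _ _ _ _ with a ≟ᶠ baseIndex i
      ...   | yes refl = sym (base≢nonHub w (cong isPaired class-i) not-hub)
      ...   | no _ rewrite base≢nonHub w (cong isPaired class-i) not-hub = xor-identityʳ _

      tails-route-hub : ∀ v j → isPaired (classify j) ≡ true →
                        tails (base j) (route v) ≡ ⌊ proj₁ v ≟ᶠ j ⌋ xor ⌊ v ≟ᵛ base j ⌋
      tails-route-hub (i , a) j paired-j with i ≟ᶠ j
      ... | no i≢j =
        let (dj , home⇒j , _) = paired-info j paired-j in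
        trans (tails-route (i , a) (base j) (⇒-irrefl home⇒j ∘ sym ∘ cong proj₁) dj (⊥-elim ∘ i≢j ∘ sym))
              (≟ᵛ-class i≢j)
      ... | yes refl with classify i
      ...   | unneeded _ = ⊥-elim (true≢false (sym paired-j))
      ...   | escape _ _ = ⊥-elim (true≢false (sym paired-j))
      ...   | paired _ _ _ _ _ with a ≟ᶠ baseIndex i
      ...     | yes refl = refl
      ...     | no a≢base rewrite ⌊⌋-no ((i , a) ≟ᵛ base i) (λ { refl → a≢base refl })
                                | ⌊⌋-yes (base i ≟ᵛ base i) refl = refl

      heads-route : ∀ v w → w ≢ x → needsIn (proj₁ w) ≡ true → heads w (route v) ≡ false
      heads-route (i , a) w w≢x dw with classify i
      ... | unneeded _ = refl
      ... | escape _ ε = heads-escape ε a w w≢x dw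
      ... | paired _ _ k _ _ with a ≟ᶠ baseIndex i
      ...   | yes _ = refl
      ...   | no _  = xor-cancelˡ ⌊ base k ≟ᵛ w ⌋ false

      route-balanced : ∀ v w → w ≢ x → oddᵇ (outDegᶜ (proj₁ w)) ≡ true → oddᵇ (inDegᶜ (proj₁ w)) ≡ true →
                       tails w (route v) ≡ heads w (route v)
      route-balanced (i , a) w w≢x odd-out odd-in with classify i
      ... | unneeded _ = refl
      ... | escape d ε = escape-balanced ε a w w≢x d odd-out odd-in
      ... | paired d _ k _ _ with a ≟ᶠ baseIndex i
      ...   | yes _ = refl
      ...   | no _ rewrite ≟ᵛ-class {(i , a)} {w} (needsOut⇒≢outOdd d odd-out)
                         | ≟ᵛ-class {base i} {w} (needsOut⇒≢outOdd d odd-out) =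
        sym (xor-cancelˡ ⌊ base k ≟ᵛ w ⌋ false)

      route-arcs : ∀ v → All IsArc (route v)
      route-arcs (i , a) with classify i
      ... | unneeded _ = []
      ... | escape _ ε = escape-arcs ε a
      ... | paired _ _ _ i⇒k _ with a ≟ᶠ baseIndex i
      ...   | yes _ = []
      ...   | no _  = i⇒k ∷ i⇒k ∷ []

      xorSum-tails-route : ∀ w → w ≢ x → needsOut (proj₁ w) ≡ true → xorSum (λ v → tails w (route v)) vertices ≡ true
      xorSum-tails-route (j , b) w≢x dw with isHub (j , b) in hub
      ... | false = trans (xorSum-cong (λ v → tails-route v (j , b) w≢x dw (λ _ → hub)) vertices) (xorSum-≟ᵛ (j , b))
      ... | true with ⌊⌋-sound (b ≟ᶠ baseIndex j) (∧-conicalʳ _ _ hub)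
      ...   | refl =
        let paired-j = ∧-conicalˡ _ _ hub
            (_ , _ , even) = paired-info j paired-j in
        trans (xorSum-cong (λ v → tails-route-hub v j paired-j) vertices)
              (trans (xorSum-class-except j (baseIndex j)) (cong not even))

    module _ (T : Tournament n) where
      open Colouring T
      private
        module Out = OutRoutes T
        module In  = OutRoutes (opposite T)

      routes : V → List (V × V)
      routes v = Out.route v ++ map swap (In.route v)

      allRoutes : List (V × V)
      allRoutes = concatMap routes vertices

      allRoutes-arcs : All IsArc allRoutes
      allRoutes-arcs = concat⁺ (map⁺ {xs = vertices} (All.tabulate λ {v} _ → ++⁺ (Out.route-arcs v) (map⁺ {f = swap} (In.route-arcs v))))

      tails-allRoutes : ∀ w → tails w allRoutes ≡
        xorSum (λ v → tails w (Out.route v)) vertices xor xorSum (λ v → heads w (In.route v)) vertices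
      tails-allRoutes w = begin
        tails w allRoutes
          ≡⟨ xorSum-concatMap _ routes vertices ⟩
        xorSum (λ v → tails w (routes v)) vertices
          ≡⟨ xorSum-cong (λ v → trans (xorSum-++ _ (Out.route v) _)
                                      (cong (tails w (Out.route v) xor_) (xorSum-map _ swap (In.route v)))) vertices ⟩
        xorSum (λ v → tails w (Out.route v) xor heads w (In.route v)) vertices
          ≡⟨ xorSum-xor _ _ vertices ⟩
        xorSum (λ v → tails w (Out.route v)) vertices xor xorSum (λ v → heads w (In.route v)) vertices ∎

      heads-allRoutes : ∀ w → heads w allRoutes ≡
        xorSum (λ v → heads w (Out.route v)) vertices xor xorSum (λ v → tails w (In.route v)) vertices
      heads-allRoutes w = begin
        heads w allRoutes
          ≡⟨ xorSum-concatMap _ routes vertices ⟩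
        xorSum (λ v → heads w (routes v)) vertices
          ≡⟨ xorSum-cong (λ v → trans (xorSum-++ _ (Out.route v) _)
                                      (cong (heads w (Out.route v) xor_) (xorSum-map _ swap (In.route v)))) vertices ⟩
        xorSum (λ v → heads w (Out.route v) xor tails w (In.route v)) vertices
          ≡⟨ xorSum-xor _ _ vertices ⟩
        xorSum (λ v → heads w (Out.route v)) vertices xor xorSum (λ v → tails w (In.route v)) vertices ∎

      allRoutes-WO : ∀ v → v ≢ x → WO T s (colouringOf allRoutes) v
      allRoutes-WO v v≢x = WO-from-colour₁ (colouringOf allRoutes) v out-demand in-demand balanced
        where
        out-demand : positiveEvenᵇ (outDeg T s v) ≡ true → oddᵇ (outCol T s (colouringOf allRoutes) v 1F) ≡ true
        out-demand d = begin
          oddᵇ (outCol T s (colouringOf allRoutes) v 1F)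
            ≡⟨ oddᵇ-outCol₁ allRoutes-arcs v ⟩
          tails v allRoutes
            ≡⟨ tails-allRoutes v ⟩
          xorSum (λ u → tails v (Out.route u)) vertices xor xorSum (λ u → heads v (In.route u)) vertices
            ≡⟨ cong₂ _xor_ (Out.xorSum-tails-route v v≢x d) (xorSum-false (λ u → In.heads-route u v v≢x d) vertices) ⟩
          true ∎

        in-demand : positiveEvenᵇ (inDeg T s v) ≡ true → oddᵇ (inCol T s (colouringOf allRoutes) v 1F) ≡ true
        in-demand d = begin
          oddᵇ (inCol T s (colouringOf allRoutes) v 1F)
            ≡⟨ oddᵇ-inCol₁ allRoutes-arcs v ⟩
          heads v allRoutes
            ≡⟨ heads-allRoutes v ⟩
          xorSum (λ u → heads v (Out.route u)) vertices xor xorSum (λ u → tails v (In.route u)) vertices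
            ≡⟨ cong₂ _xor_ (xorSum-false (λ u → Out.heads-route u v v≢x d) vertices) (In.xorSum-tails-route v v≢x d) ⟩
          true ∎

        balanced : oddᵇ (outDeg T s v) ≡ true → oddᵇ (inDeg T s v) ≡ true →
                   oddᵇ (outCol T s (colouringOf allRoutes) v 1F) ≡ oddᵇ (inCol T s (colouringOf allRoutes) v 1F)
        balanced odd-out odd-in = begin
          oddᵇ (outCol T s (colouringOf allRoutes) v 1F)
            ≡⟨ oddᵇ-outCol₁ allRoutes-arcs v ⟩
          tails v allRoutes
            ≡⟨ tails-allRoutes v ⟩
          xorSum (λ u → tails v (Out.route u)) vertices xor xorSum (λ u → heads v (In.route u)) vertices
            ≡⟨ cong₂ _xor_ (xorSum-cong (λ u → Out.route-balanced u v v≢x odd-out odd-in) vertices)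
                           (sym (xorSum-cong (λ u → In.route-balanced u v v≢x odd-in odd-out) vertices)) ⟩
          xorSum (λ u → heads v (Out.route u)) vertices xor xorSum (λ u → tails v (In.route u)) vertices
            ≡⟨ sym (heads-allRoutes v) ⟩
          heads v allRoutes
            ≡⟨ sym (oddᵇ-inCol₁ allRoutes-arcs v) ⟩
          oddᵇ (inCol T s (colouringOf allRoutes) v 1F) ∎

proposition4p6 : (n : ℕ) (T : Tournament n) (s : Fin n → ℕ) → (∀ i → s i ≥ 1) →
                   WeakOddChromaticIndex≡ T s 3 →
                   (x : ETVertex s) →
                   Σ (ArcColouring s 2) (λ φ → ∀ v → v ≢ x → WO T s φ v)
proposition4p6 n T s s≥1 _ x = colouringOf (allRoutes T) , allRoutes-WO T
  where
  open ExtendedTournament s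
  open Construction s≥1 x
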